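{- Let $q=2^r$ with $r\ge3$, $m\in\mathbb{Z}_{>0}$, and $N_2=(q-1)^m$. Then the map $\mathbb{F}_q\to D_m^\perp$, $a\mapsto d(a)$, is an $\mathbb{F}_2$-linear isomorphism.
   Context: $tr:\mathbb{F}_q\to\mathbb{F}_2$ is the absolute trace. Fix an ordering of $(\mathbb{F}_q^*)^m$ and let $w_m=(g_1,\dots,g_{N_2})\in\mathbb{F}_q^{N_2}$ with $g_i=\alpha_1+\cdots+\alpha_m+\alpha_1^{ -1}+\cdots+\alpha_m^{ -1}$ for the $i$-th tuple $(\alpha_1,\dots,\alpha_m)$. $D_m=\{u\in\mathbb{F}_2^{N_2}:\sum_iu_ig_i=0\text{ in }\mathbb{F}_q\}$ and $D_m^\perp$ is its dual with respect to the standard inner product on $\mathbb{F}_2^{N_2}$. For $a\in\mathbb{F}_q$, $d(a)=(tr(ag_1),\dots,tr(ag_{N_2}))$; one has $D_m^\perp=\{d(a):a\in\mathbb{F}_q\}$. -}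

module Defs where

open import Level using (0ℓ)
open import Algebra.Bundles using (CommutativeRing)
open import Data.Nat using (ℕ; zero; suc; _^_; _∸_)
open import Data.Fin using (Fin)
import Data.Fin
open import Data.Bool using (Bool; true; false; _xor_; _∧_; if_then_else_)
open import Data.Product using (Σ; ∃; _×_; _,_)
open import Relation.Nullary using (¬_; does)
open import Relation.Binary.Definitions using (Decidable)
open import Relation.Binary.PropositionalEquality using (_≡_)

record FiniteField (q : ℕ) : Set₁ where
  field
    ring : CommutativeRing 0ℓ 0ℓ
  open CommutativeRing ring
  field
    ≈⇒≡        : ∀ {x y} → x ≈ y → x ≡ y
    _≟_        : Decidable _≈_
    nontrivial : ¬ (1# ≈ 0#)
    _⁻¹        : Carrier → Carrier
    inverseʳ   : ∀ x → ¬ (x ≈ 0#) → (x * (x ⁻¹)) ≈ 1#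
    enum       : Fin q → Carrier
    enum-inj   : ∀ i j → enum i ≡ enum j → i ≡ j
    enum-surj  : ∀ x → ∃ λ i → enum i ≡ x

module _ {q : ℕ} (F : FiniteField q) where
  open FiniteField F
  open CommutativeRing ring

  pow : Carrier → ℕ → Carrier
  pow x zero    = 1#
  pow x (suc n) = x * pow x n

  sumF : (n : ℕ) → (Fin n → Carrier) → Carrier
  sumF zero    f = 0#
  sumF (suc n) f = f Fin.zero + sumF n (λ i → f (Fin.suc i))

  trF : ℕ → Carrier → Carrier
  trF r x = sumF r (λ k → pow x (2 ^ Data.Fin.toℕ k))

  -- the trace viewed in F_2 = Bool (1 ↦ true, 0 ↦ false)
  tr : ℕ → Carrier → Bool
  tr r x = does (trF r x ≟ 1#)

  emb : Bool → Carrier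
  emb b = if b then 1# else 0#

  NonzeroTuple : (m : ℕ) → (Fin m → Carrier) → Set
  NonzeroTuple m t = ∀ k → ¬ (t k ≈ 0#)

  record IsOrdering (m N : ℕ) (ord : Fin N → Fin m → Carrier) : Set where
    field
      nonzero : ∀ i → NonzeroTuple m (ord i)
      inj     : ∀ i j → (∀ k → ord i k ≡ ord j k) → i ≡ j
      surj    : ∀ t → NonzeroTuple m t → ∃ λ i → ∀ k → ord i k ≡ t k

  gvec : (m N : ℕ) → (Fin N → Fin m → Carrier) → Fin N → Carrier
  gvec m N ord i = sumF m (ord i) + sumF m (λ k → (ord i k) ⁻¹)

  InD : (N : ℕ) → (g : Fin N → Carrier) → (Fin N → Bool) → Set
  InD N g u = sumF N (λ i → emb (u i) * g i) ≈ 0#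

  dvec : (r N : ℕ) → (g : Fin N → Carrier) → Carrier → Fin N → Bool
  dvec r N g a i = tr r (a * g i)

dotB : (n : ℕ) → (Fin n → Bool) → (Fin n → Bool) → Bool
dotB zero    u v = false
dotB (suc n) u v = (u Fin.zero ∧ v Fin.zero) xor dotB n (λ i → u (Fin.suc i)) (λ i → v (Fin.suc i))

module _ {q : ℕ} (F : FiniteField q) where
  open FiniteField F using (ring)
  open CommutativeRing ring using (Carrier)
  InD⊥ : (N : ℕ) → (g : Fin N → Carrier) → (Fin N → Bool) → Set
  InD⊥ N g v = ∀ u → InD F N g u → dotB N u v ≡ false

{-# OPTIONS --safe #-}
-- In characteristic 2 the absolute trace is additive with values in F₂, so a ↦ d(a) is F₂-linear,
-- and d(a) ⊥ u for u ∈ D_m because Σ uᵢ tr(a gᵢ) = tr(a Σ uᵢ gᵢ) = tr(0) = 0.  For injectivity,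
-- every c ≠ 0 has some x ≠ 0 with tr(c (x + x⁻¹)) = 1: otherwise x · tr(c (x + x⁻¹)), a
-- polynomial of degree q - 1 with leading coefficient c once q > 4, would vanish on all of F_q.
-- The tuple (x, 1, …, 1) has g = x + x⁻¹, so d(c) ≠ 0.  Surjectivity onto D_m^⊥ is linear algebra
-- over F₂: adding the gᵢ one at a time, a vector orthogonal to every F₂-relation among them is
-- (tr(a gᵢ))ᵢ for some a; an element of trace 1 makes the trace form nondegenerate.
module Submission where

open import Defs
open import Algebra.Bundles using (CommutativeRing)
open import Data.Nat as ℕ using (ℕ; zero; suc; _^_; _∸_; _≤_; _<_; z≤n; s≤s)
import Data.Nat.Properties as ℕₚ
open import Data.Fin as Fin using (Fin; toℕ)
import Data.Fin.Properties as Finₚ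
open import Data.Bool as Bool using (Bool; true; false; _xor_; _∧_)
open import Data.Bool.Properties using (xor-same; xor-assoc; xor-identityʳ; ∧-comm; ∧-zeroʳ; ∧-identityʳ; ¬-not)
open import Data.Vec using (Vec; []; _∷_; replicate; zipWith)
open import Data.Vec.Functional using (head; tail) renaming (_∷_ to _∷ᵥ_)
open import Data.Product using (∃; _×_; _,_; proj₁; proj₂)
open import Data.Sum using (_⊎_; inj₁; inj₂)
open import Data.Empty using (⊥-elim)
open import Relation.Nullary using (¬_; yes; no; ¬?; _×-dec_)
open import Relation.Binary.PropositionalEquality
  using (_≡_; refl; sym; trans; cong; cong₂; subst; module ≡-Reasoning)
open import Data.Fin.Permutation using (Permutation; permutation)
import Algebra.Properties.CommutativeMonoid.Sum as MonoidSum
import Algebra.Properties.Ring as RingProperties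
import Algebra.Solver.Ring.NaturalCoefficients.Default as NaturalCoefficientsSolver

module FieldLemmas {q : ℕ} (F : FiniteField q) where
  open FiniteField F
  open CommutativeRing ring using (Carrier; _+_; _*_; -_; 0#; 1#; _≈_)
  private
    module R = CommutativeRing ring
    module RP = RingProperties R.ring
  open NaturalCoefficientsSolver (CommutativeRing.commutativeSemiring ring) public
    using (solve; _:+_; _:*_; _:=_)

  Nonzero : Carrier → Set
  Nonzero x = ¬ (x ≈ 0#)

  +-identityˡ : ∀ x → 0# + x ≡ x
  +-identityˡ x = ≈⇒≡ (R.+-identityˡ x)

  +-identityʳ : ∀ x → x + 0# ≡ x
  +-identityʳ x = ≈⇒≡ (R.+-identityʳ x)

  *-identityˡ : ∀ x → 1# * x ≡ x
  *-identityˡ x = ≈⇒≡ (R.*-identityˡ x)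

  *-identityʳ : ∀ x → x * 1# ≡ x
  *-identityʳ x = ≈⇒≡ (R.*-identityʳ x)

  zeroˡ : ∀ x → 0# * x ≡ 0#
  zeroˡ x = ≈⇒≡ (R.zeroˡ x)

  zeroʳ : ∀ x → x * 0# ≡ 0#
  zeroʳ x = ≈⇒≡ (R.zeroʳ x)

  +-comm : ∀ x y → x + y ≡ y + x
  +-comm x y = ≈⇒≡ (R.+-comm x y)

  +-assoc : ∀ x y z → (x + y) + z ≡ x + (y + z)
  +-assoc x y z = ≈⇒≡ (R.+-assoc x y z)

  *-comm : ∀ x y → x * y ≡ y * x
  *-comm x y = ≈⇒≡ (R.*-comm x y)

  *-assoc : ∀ x y z → (x * y) * z ≡ x * (y * z)
  *-assoc x y z = ≈⇒≡ (R.*-assoc x y z)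

  distribˡ : ∀ x y z → x * (y + z) ≡ x * y + x * z
  distribˡ x y z = ≈⇒≡ (R.distribˡ x y z)

  distribʳ : ∀ x y z → (y + z) * x ≡ y * x + z * x
  distribʳ x y z = ≈⇒≡ (R.distribʳ x y z)

  +-cancelˡ : ∀ x y z → x + y ≡ x + z → y ≡ z
  +-cancelˡ x y z e = ≈⇒≡ (RP.+-cancelˡ x y z (R.reflexive e))

  ⁻¹-inverseʳ : ∀ {x} → Nonzero x → x * x ⁻¹ ≡ 1#
  ⁻¹-inverseʳ {x} x≉0 = ≈⇒≡ (inverseʳ x x≉0)

  ⁻¹-inverseˡ : ∀ {x} → Nonzero x → x ⁻¹ * x ≡ 1#
  ⁻¹-inverseˡ x≉0 = trans (*-comm _ _) (⁻¹-inverseʳ x≉0)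

  1⁻¹≡1 : 1# ⁻¹ ≡ 1#
  1⁻¹≡1 = trans (sym (*-identityˡ _)) (⁻¹-inverseʳ nontrivial)

  x*y≡0⇒y≡0 : ∀ {x y} → Nonzero x → x * y ≡ 0# → y ≡ 0#
  x*y≡0⇒y≡0 {x} {y} x≉0 xy≡0 = begin
    y                ≡⟨ sym (*-identityˡ y) ⟩
    1# * y           ≡⟨ cong (_* y) (sym (⁻¹-inverseˡ x≉0)) ⟩
    (x ⁻¹ * x) * y   ≡⟨ *-assoc _ _ _ ⟩
    x ⁻¹ * (x * y)   ≡⟨ cong (x ⁻¹ *_) xy≡0 ⟩
    x ⁻¹ * 0#        ≡⟨ zeroʳ _ ⟩
    0#               ∎
    where open ≡-Reasoning

  *-nonzero : ∀ {x y} → Nonzero x → Nonzero y → Nonzero (x * y)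
  *-nonzero x≉0 y≉0 xy≈0 = y≉0 (R.reflexive (x*y≡0⇒y≡0 x≉0 (≈⇒≡ xy≈0)))

  *-cancelʳ : ∀ {x y z} → Nonzero z → x * z ≡ y * z → x ≡ y
  *-cancelʳ {x} {y} {z} z≉0 xz≡yz = begin
    x                  ≡⟨ sym (*-identityʳ x) ⟩
    x * 1#             ≡⟨ cong (x *_) (sym (⁻¹-inverseʳ z≉0)) ⟩
    x * (z * z ⁻¹)     ≡⟨ sym (*-assoc _ _ _) ⟩
    (x * z) * z ⁻¹     ≡⟨ cong (_* z ⁻¹) xz≡yz ⟩
    (y * z) * z ⁻¹     ≡⟨ *-assoc _ _ _ ⟩
    y * (z * z ⁻¹)     ≡⟨ cong (y *_) (⁻¹-inverseʳ z≉0) ⟩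
    y * 1#             ≡⟨ *-identityʳ y ⟩
    y                  ∎
    where open ≡-Reasoning

  sumF-cong : ∀ n {f g : Fin n → Carrier} → (∀ i → f i ≡ g i) → sumF F n f ≡ sumF F n g
  sumF-cong zero    f≗g = refl
  sumF-cong (suc n) f≗g = cong₂ _+_ (f≗g Fin.zero) (sumF-cong n (λ i → f≗g (Fin.suc i)))

  sumF-hom : ∀ (φ : Carrier → Carrier) → φ 0# ≡ 0# → (∀ x y → φ (x + y) ≡ φ x + φ y) →
             ∀ n (f : Fin n → Carrier) → φ (sumF F n f) ≡ sumF F n (λ i → φ (f i))
  sumF-hom φ φ0 φ+ zero    f = φ0
  sumF-hom φ φ0 φ+ (suc n) f = trans (φ+ _ _) (cong (φ (f Fin.zero) +_) (sumF-hom φ φ0 φ+ n _))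

  sumF-distrib-+ : ∀ n (f g : Fin n → Carrier) →
                   sumF F n (λ i → f i + g i) ≡ sumF F n f + sumF F n g
  sumF-distrib-+ zero    f g = sym (+-identityʳ 0#)
  sumF-distrib-+ (suc n) f g =
    trans (cong (f Fin.zero + g Fin.zero +_) (sumF-distrib-+ n _ _))
          (≈⇒≡ (solve 4 (λ a b c d → ((a :+ b) :+ (c :+ d)) := ((a :+ c) :+ (b :+ d))) R.refl
                        (f Fin.zero) (g Fin.zero) (sumF F n _) (sumF F n _)))

  *-distribˡ-sumF : ∀ n x (f : Fin n → Carrier) → x * sumF F n f ≡ sumF F n (λ i → x * f i)
  *-distribˡ-sumF n x = sumF-hom (x *_) (zeroʳ x) (distribˡ x) n

  sumF-rotate : ∀ n (G : ℕ → Carrier) →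
                sumF F n (λ i → G (suc (toℕ i))) + G 0 ≡ sumF F n (λ i → G (toℕ i)) + G n
  sumF-rotate zero    G = refl
  sumF-rotate (suc n) G = begin
    (G 1 + A) + G 0      ≡⟨ cong (_+ G 0) (+-comm (G 1) A) ⟩
    (A + G 1) + G 0      ≡⟨ cong (_+ G 0) (sumF-rotate n (λ k → G (suc k))) ⟩
    (B + G (suc n)) + G 0 ≡⟨ ≈⇒≡ (solve 3 (λ b c d → ((b :+ c) :+ d) := ((d :+ b) :+ c))
                                          R.refl B (G (suc n)) (G 0)) ⟩
    (G 0 + B) + G (suc n) ∎
    where
    open ≡-Reasoning
    A B : Carrier
    A = sumF F n (λ i → G (suc (suc (toℕ i))))
    B = sumF F n (λ i → G (suc (toℕ i)))

  pow-+ : ∀ x m n → pow F x (m ℕ.+ n) ≡ pow F x m * pow F x n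
  pow-+ x zero    n = sym (*-identityˡ _)
  pow-+ x (suc m) n = trans (cong (x *_) (pow-+ x m n)) (sym (*-assoc _ _ _))

  pow-double : ∀ x n → pow F x (n ℕ.+ (n ℕ.+ 0)) ≡ pow F x n * pow F x n
  pow-double x n = trans (pow-+ x n _) (cong (λ k → pow F x n * pow F x k) (ℕₚ.+-identityʳ n))

  pow-distrib-* : ∀ x y n → pow F (x * y) n ≡ pow F x n * pow F y n
  pow-distrib-* x y zero    = sym (*-identityʳ 1#)
  pow-distrib-* x y (suc n) =
    trans (cong (x * y *_) (pow-distrib-* x y n))
          (≈⇒≡ (solve 4 (λ a b c d → ((a :* b) :* (c :* d)) := ((a :* c) :* (b :* d))) R.refl
                        x y (pow F x n) (pow F y n)))

  pow-1# : ∀ n → pow F 1# n ≡ 1#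
  pow-1# zero    = refl
  pow-1# (suc n) = trans (cong (1# *_) (pow-1# n)) (*-identityˡ 1#)

  pow-⁻¹ : ∀ {x} n → Nonzero x → pow F x n * pow F (x ⁻¹) n ≡ 1#
  pow-⁻¹ {x} n x≉0 =
    trans (sym (pow-distrib-* x (x ⁻¹) n)) (trans (cong (λ y → pow F y n) (⁻¹-inverseʳ x≉0)) (pow-1# n))

-- Multiplication by a unit x permutes the elements, so the product of the units is also their
-- product after scaling each by x, i.e. x ^ #units times itself.  (unitPart replaces 0 by 1, so
-- that the products may range over all of F.)
module Fermat {q : ℕ} (F : FiniteField q) where
  open FiniteField F
  open CommutativeRing ring using (Carrier; _*_; 0#; 1#; _≈_)
  open FieldLemmas F
  private
    module R = CommutativeRing ring
    module Π = MonoidSum R.*-commutativeMonoid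

  countNonzero : ∀ n → (Fin n → Carrier) → ℕ
  countNonzero zero    f = 0
  countNonzero (suc n) f with f Fin.zero ≟ 0#
  ... | yes _ = countNonzero n (λ i → f (Fin.suc i))
  ... | no  _ = suc (countNonzero n (λ i → f (Fin.suc i)))

  countNonzero-all : ∀ n (f : Fin n → Carrier) → (∀ i → Nonzero (f i)) → countNonzero n f ≡ n
  countNonzero-all zero    f f≉0 = refl
  countNonzero-all (suc n) f f≉0 with f Fin.zero ≟ 0#
  ... | yes f0≈0 = ⊥-elim (f≉0 Fin.zero f0≈0)
  ... | no  _    = cong suc (countNonzero-all n _ (λ i → f≉0 (Fin.suc i)))

  countNonzero-one : ∀ n (f : Fin n → Carrier) i₀ → f i₀ ≈ 0# →
                     (∀ i j → f i ≈ 0# → f j ≈ 0# → i ≡ j) → suc (countNonzero n f) ≡ n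
  countNonzero-one (suc n) f i₀ fi₀≈0 unique with f Fin.zero ≟ 0#
  ... | yes f0≈0 =
    cong suc (countNonzero-all n _ (λ i fi≈0 → Finₚ.0≢1+n (unique _ _ f0≈0 fi≈0)))
  countNonzero-one (suc n) f Fin.zero      fi₀≈0 unique | no f0≉0 = ⊥-elim (f0≉0 fi₀≈0)
  countNonzero-one (suc n) f (Fin.suc i₀) fi₀≈0 unique | no _ =
    cong suc (countNonzero-one n _ i₀ fi₀≈0 (λ i j p q → Finₚ.suc-injective (unique _ _ p q)))

  #units : ℕ
  #units = countNonzero q enum

  suc-#units : suc #units ≡ q
  suc-#units = countNonzero-one q enum (proj₁ (enum-surj 0#)) (R.reflexive (proj₂ (enum-surj 0#)))
    (λ i j p q → enum-inj i j (trans (≈⇒≡ p) (sym (≈⇒≡ q))))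

  unitPart : Carrier → Carrier
  unitPart y with y ≟ 0#
  ... | yes _ = 1#
  ... | no  _ = y

  unitFactor : Carrier → Carrier → Carrier
  unitFactor x y with y ≟ 0#
  ... | yes _ = 1#
  ... | no  _ = x

  unitPart-nonzero : ∀ y → Nonzero (unitPart y)
  unitPart-nonzero y with y ≟ 0#
  ... | yes _   = nontrivial
  ... | no  y≉0 = y≉0

  unitPart-* : ∀ {x} y → Nonzero x → unitPart (x * y) ≡ unitFactor x y * unitPart y
  unitPart-* {x} y x≉0 with y ≟ 0# | (x * y) ≟ 0#
  ... | yes _   | yes _    = sym (*-identityˡ 1#)
  ... | yes y≈0 | no xy≉0  = ⊥-elim (xy≉0 (R.reflexive (trans (cong (x *_) (≈⇒≡ y≈0)) (zeroʳ x))))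
  ... | no  y≉0 | yes xy≈0 = ⊥-elim (y≉0 (R.reflexive (x*y≡0⇒y≡0 x≉0 (≈⇒≡ xy≈0))))
  ... | no  _   | no _     = refl

  ∏-unitFactor : ∀ x n (f : Fin n → Carrier) →
                 Π.sum (λ i → unitFactor x (f i)) ≡ pow F x (countNonzero n f)
  ∏-unitFactor x zero    f = refl
  ∏-unitFactor x (suc n) f with f Fin.zero ≟ 0#
  ... | yes _ = trans (*-identityˡ _) (∏-unitFactor x n _)
  ... | no  _ = cong (x *_) (∏-unitFactor x n _)

  ∏-nonzero : ∀ n (f : Fin n → Carrier) → (∀ i → Nonzero (f i)) → Nonzero (Π.sum f)
  ∏-nonzero zero    f f≉0 = nontrivial
  ∏-nonzero (suc n) f f≉0 = *-nonzero (f≉0 Fin.zero) (∏-nonzero n _ (λ i → f≉0 (Fin.suc i)))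

  fermat-unit : ∀ {x} → Nonzero x → pow F x #units ≡ 1#
  fermat-unit {x} x≉0 = *-cancelʳ (∏-nonzero q units (λ i → unitPart-nonzero _)) (begin
    pow F x #units * ∏units           ≡⟨ cong (_* ∏units) (sym (∏-unitFactor x q enum)) ⟩
    Π.sum (λ i → unitFactor x (enum i)) * ∏units
                                      ≡⟨ sym (≈⇒≡ (Π.∑-distrib-+ (λ i → unitFactor x (enum i)) units)) ⟩
    Π.sum (λ i → unitFactor x (enum i) * units i)
                                      ≡⟨ Π.sum-cong-≗ {q} (λ i → sym (unitPart-* (enum i) x≉0)) ⟩
    Π.sum (λ i → unitPart (x * enum i))
                                      ≡⟨ Π.sum-cong-≗ {q} (λ i → cong unitPart (sym (enum∘enum⁻¹ _))) ⟩
    Π.sum (λ i → units (scale x i))   ≡⟨ sym (≈⇒≡ (Π.sum-permute units scaling)) ⟩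
    ∏units                            ≡⟨ sym (*-identityˡ _) ⟩
    1# * ∏units                       ∎)
    where
    open ≡-Reasoning
    units : Fin q → Carrier
    units i = unitPart (enum i)
    ∏units : Carrier
    ∏units = Π.sum units
    enum⁻¹ : Carrier → Fin q
    enum⁻¹ y = proj₁ (enum-surj y)
    enum∘enum⁻¹ : ∀ y → enum (enum⁻¹ y) ≡ y
    enum∘enum⁻¹ y = proj₂ (enum-surj y)
    scale : Carrier → Fin q → Fin q
    scale y i = enum⁻¹ (y * enum i)
    scale-inverse : ∀ {y z} → y * z ≡ 1# → ∀ i → scale y (scale z i) ≡ i
    scale-inverse {y} {z} yz≡1 i = enum-inj _ _ (begin
      enum (scale y (scale z i))  ≡⟨ enum∘enum⁻¹ _ ⟩
      y * enum (scale z i)        ≡⟨ cong (y *_) (enum∘enum⁻¹ _) ⟩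
      y * (z * enum i)            ≡⟨ sym (*-assoc _ _ _) ⟩
      (y * z) * enum i            ≡⟨ cong (_* enum i) yz≡1 ⟩
      1# * enum i                 ≡⟨ *-identityˡ _ ⟩
      enum i                      ∎)
    scaling : Permutation q q
    scaling = permutation (scale x) (scale (x ⁻¹))
                          (scale-inverse (⁻¹-inverseʳ x≉0)) (scale-inverse (⁻¹-inverseˡ x≉0))

  fermat : ∀ x → pow F x q ≡ x
  fermat x = subst (λ n → pow F x n ≡ x) suc-#units (fermat-suc x)
    where
    fermat-suc : ∀ x → pow F x (suc #units) ≡ x
    fermat-suc x with x ≟ 0#
    ... | yes x≈0 = trans (cong (_* pow F x #units) (≈⇒≡ x≈0)) (trans (zeroˡ _) (sym (≈⇒≡ x≈0)))
    ... | no  x≉0 = trans (cong (x *_) (fermat-unit x≉0)) (*-identityʳ x)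

  pow-∸ : ∀ x {n} → n < q → pow F x (q ∸ n) ≡ x * pow F (x ⁻¹) n
  pow-∸ x {n} n<q with x ≟ 0#
  ... | yes x≈0 = begin
    pow F x (q ∸ n)          ≡⟨ cong (λ y → pow F y (q ∸ n)) (≈⇒≡ x≈0) ⟩
    pow F 0# (q ∸ n)         ≡⟨ pow-0# (q ∸ n) (ℕₚ.m<n⇒0<n∸m n<q) ⟩
    0#                       ≡⟨ sym (zeroˡ _) ⟩
    0# * pow F (x ⁻¹) n      ≡⟨ cong (_* pow F (x ⁻¹) n) (sym (≈⇒≡ x≈0)) ⟩
    x * pow F (x ⁻¹) n       ∎
    where
    open ≡-Reasoning
    pow-0# : ∀ e → 0 < e → pow F 0# e ≡ 0#
    pow-0# (suc e) _ = zeroˡ _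
  ... | no  x≉0 = begin
    pow F x (q ∸ n)                      ≡⟨ sym (*-identityʳ _) ⟩
    pow F x (q ∸ n) * 1#                 ≡⟨ cong (pow F x (q ∸ n) *_) (sym (pow-⁻¹ n x≉0)) ⟩
    pow F x (q ∸ n) * (pow F x n * Y)    ≡⟨ sym (*-assoc _ _ _) ⟩
    (pow F x (q ∸ n) * pow F x n) * Y    ≡⟨ cong (_* Y) (sym (pow-+ x (q ∸ n) n)) ⟩
    pow F x (q ∸ n ℕ.+ n) * Y            ≡⟨ cong (λ e → pow F x e * Y) (ℕₚ.m∸n+n≡m (ℕₚ.<⇒≤ n<q)) ⟩
    pow F x q * Y                        ≡⟨ cong (_* Y) (fermat x) ⟩
    x * Y                                ∎
    where
    open ≡-Reasoning
    Y : Carrier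
    Y = pow F (x ⁻¹) n

module Polynomials {q : ℕ} (F : FiniteField q) where
  open FiniteField F
  open CommutativeRing ring using (Carrier; _+_; _*_; 0#; 1#; _≈_)
  open FieldLemmas F
  private
    module R = CommutativeRing ring

  -- Coefficient vectors in ascending order: Poly n has degree at most n, and leading reads off
  -- the coefficient of xⁿ (possibly 0).
  Poly : ℕ → Set
  Poly n = Vec Carrier (suc n)

  eval : ∀ {n} → Vec Carrier n → Carrier → Carrier
  eval []       x = 0#
  eval (c ∷ cs) x = c + x * eval cs x

  leading : ∀ {n} → Poly n → Carrier
  leading (c ∷ [])     = c
  leading (c ∷ d ∷ ds) = leading (d ∷ ds)

  leading-∷ : ∀ {n} c (p : Poly n) → leading (c ∷ p) ≡ leading p
  leading-∷ c (d ∷ ds) = refl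

  -- quotient of p(x) - p(a) by x - a
  divideByRoot : ∀ {n} → Poly (suc n) → Carrier → Poly n
  divideByRoot (c ∷ d ∷ [])     a = d ∷ []
  divideByRoot (c ∷ d ∷ e ∷ es) a = eval (d ∷ e ∷ es) a ∷ divideByRoot (d ∷ e ∷ es) a

  eval-divideByRoot : ∀ {n} (p : Poly (suc n)) a x →
    eval p x + a * eval (divideByRoot p a) x ≡ x * eval (divideByRoot p a) x + eval p a
  eval-divideByRoot (c ∷ d ∷ []) a x = begin
    (c + x * D x) + a * D x        ≡⟨ cong₂ (λ u v → (c + x * u) + a * v) (eval-const x) (eval-const x) ⟩
    (c + x * d) + a * d            ≡⟨ ≈⇒≡ (solve 4 (λ c d x a →
                                          ((c :+ x :* d) :+ a :* d) := (x :* d :+ (c :+ a :* d)))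
                                          R.refl c d x a) ⟩
    x * d + (c + a * d)            ≡⟨ sym (cong₂ (λ u v → x * u + (c + a * v)) (eval-const x) (eval-const a)) ⟩
    x * D x + (c + a * D a)        ∎
    where
    open ≡-Reasoning
    D : Carrier → Carrier
    D = eval (d ∷ [])
    eval-const : ∀ y → D y ≡ d
    eval-const y = trans (cong (d +_) (zeroʳ y)) (+-identityʳ d)
  eval-divideByRoot (c ∷ p@(d ∷ e ∷ es)) a x = begin
    (c + x * P) + a * (Pa + x * Q)   ≡⟨ ≈⇒≡ (solve 6 (λ c x P a Pa Q →
                                          ((c :+ x :* P) :+ a :* (Pa :+ x :* Q)) := ((c :+ a :* Pa) :+ x :* (P :+ a :* Q)))
                                          R.refl c x P a Pa Q) ⟩
    (c + a * Pa) + x * (P + a * Q)   ≡⟨ cong (λ y → (c + a * Pa) + x * y) (eval-divideByRoot p a x) ⟩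
    (c + a * Pa) + x * (x * Q + Pa)  ≡⟨ ≈⇒≡ (solve 5 (λ c a Pa x xQ →
                                          ((c :+ a :* Pa) :+ x :* (xQ :+ Pa)) := (x :* (Pa :+ xQ) :+ (c :+ a :* Pa)))
                                          R.refl c a Pa x (x * Q)) ⟩
    x * (Pa + x * Q) + (c + a * Pa)  ∎
    where
    open ≡-Reasoning
    P Pa Q : Carrier
    P  = eval p x
    Pa = eval p a
    Q  = eval (divideByRoot p a) x

  leading-divideByRoot : ∀ {n} (p : Poly (suc n)) a → leading (divideByRoot p a) ≡ leading p
  leading-divideByRoot (c ∷ d ∷ [])     a = refl
  leading-divideByRoot (c ∷ p@(d ∷ e ∷ es)) a =
    trans (leading-∷ _ (divideByRoot p a)) (leading-divideByRoot p a)

  many-roots⇒leading≡0 : ∀ {n k} (p : Poly n) (xs : Fin k → Carrier) →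
    (∀ i j → xs i ≡ xs j → i ≡ j) → n < k → (∀ i → eval p (xs i) ≡ 0#) → leading p ≡ 0#
  many-roots⇒leading≡0 {zero} (c ∷ []) xs xs-inj (s≤s _) roots =
    trans (sym (trans (cong (c +_) (zeroʳ _)) (+-identityʳ c))) (roots Fin.zero)
  many-roots⇒leading≡0 {suc n} {suc k} p xs xs-inj (s≤s n<k) roots =
    trans (sym (leading-divideByRoot p a))
          (many-roots⇒leading≡0 (divideByRoot p a) (λ i → xs (Fin.suc i))
                              (λ i j e → Finₚ.suc-injective (xs-inj _ _ e)) n<k quotient-roots)
    where
    a : Carrier
    a = xs Fin.zero
    quotient-roots : ∀ i → eval (divideByRoot p a) (xs (Fin.suc i)) ≡ 0#
    quotient-roots i with eval (divideByRoot p a) (xs (Fin.suc i)) ≟ 0#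
    ... | yes Q≈0 = ≈⇒≡ Q≈0
    ... | no  Q≉0 = ⊥-elim (Finₚ.0≢1+n (xs-inj _ _ (*-cancelʳ Q≉0 (begin
      a * Q            ≡⟨ sym (+-identityˡ _) ⟩
      0# + a * Q       ≡⟨ cong (_+ a * Q) (sym (roots (Fin.suc i))) ⟩
      eval p b + a * Q ≡⟨ eval-divideByRoot p a b ⟩
      b * Q + eval p a ≡⟨ cong (b * Q +_) (roots Fin.zero) ⟩
      b * Q + 0#       ≡⟨ +-identityʳ _ ⟩
      b * Q            ∎))))
      where
      open ≡-Reasoning
      b Q : Carrier
      b = xs (Fin.suc i)
      Q = eval (divideByRoot p a) b

  infixl 6 _⊞_
  _⊞_ : ∀ {n} → Vec Carrier n → Vec Carrier n → Vec Carrier n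
  _⊞_ = zipWith _+_

  eval-⊞ : ∀ {n} (p p′ : Vec Carrier n) x → eval (p ⊞ p′) x ≡ eval p x + eval p′ x
  eval-⊞ []       []         x = sym (+-identityʳ 0#)
  eval-⊞ (c ∷ cs) (c′ ∷ cs′) x =
    trans (cong (λ y → (c + c′) + x * y) (eval-⊞ cs cs′ x))
          (≈⇒≡ (solve 5 (λ c c′ x P P′ →
                           ((c :+ c′) :+ x :* (P :+ P′)) := ((c :+ x :* P) :+ (c′ :+ x :* P′)))
                        R.refl c c′ x (eval cs x) (eval cs′ x)))

  leading-⊞ : ∀ {n} (p p′ : Poly n) → leading (p ⊞ p′) ≡ leading p + leading p′
  leading-⊞ (c ∷ [])     (c′ ∷ [])       = refl
  leading-⊞ (c ∷ d ∷ ds) (c′ ∷ d′ ∷ ds′) = leading-⊞ (d ∷ ds) (d′ ∷ ds′)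

  eval-replicate-0# : ∀ n x → eval (replicate n 0#) x ≡ 0#
  eval-replicate-0# zero    x = refl
  eval-replicate-0# (suc n) x =
    trans (cong (λ y → 0# + x * y) (eval-replicate-0# n x)) (trans (+-identityˡ _) (zeroʳ x))

  leading-replicate-0# : ∀ n → leading (replicate (suc n) 0#) ≡ 0#
  leading-replicate-0# zero    = refl
  leading-replicate-0# (suc n) = leading-replicate-0# n

  monomial : ∀ {n} e → e ≤ n → Carrier → Poly n
  monomial zero    z≤n       c = c ∷ replicate _ 0#
  monomial (suc e) (s≤s e≤n) c = 0# ∷ monomial e e≤n c

  eval-monomial : ∀ {n} e (e≤n : e ≤ n) c x → eval (monomial e e≤n c) x ≡ c * pow F x e
  eval-monomial {n} zero z≤n c x = begin
    c + x * eval (replicate n 0#) x  ≡⟨ cong (λ y → c + x * y) (eval-replicate-0# n x) ⟩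
    c + x * 0#                       ≡⟨ cong (c +_) (zeroʳ x) ⟩
    c + 0#                           ≡⟨ +-identityʳ c ⟩
    c                                ≡⟨ sym (*-identityʳ c) ⟩
    c * 1#                           ∎
    where open ≡-Reasoning
  eval-monomial (suc e) (s≤s e≤n) c x = begin
    0# + x * eval (monomial e e≤n c) x  ≡⟨ +-identityˡ _ ⟩
    x * eval (monomial e e≤n c) x       ≡⟨ cong (x *_) (eval-monomial e e≤n c x) ⟩
    x * (c * pow F x e)                 ≡⟨ ≈⇒≡ (solve 3 (λ x c y → (x :* (c :* y)) := (c :* (x :* y)))
                                                   R.refl x c (pow F x e)) ⟩
    c * (x * pow F x e)                 ∎
    where open ≡-Reasoning

  leading-monomial-top : ∀ n (n≤n : n ≤ n) c → leading (monomial n n≤n c) ≡ c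
  leading-monomial-top zero    z≤n       c = refl
  leading-monomial-top (suc n) (s≤s n≤n) c =
    trans (leading-∷ 0# (monomial n n≤n c)) (leading-monomial-top n n≤n c)

  leading-monomial-low : ∀ {n} e (e≤n : e ≤ n) c → e < n → leading (monomial e e≤n c) ≡ 0#
  leading-monomial-low {suc n} zero    z≤n       c _ = leading-replicate-0# n
  leading-monomial-low {suc n} (suc e) (s≤s e≤n) c (s≤s e<n) =
    trans (leading-∷ 0# (monomial e e≤n c)) (leading-monomial-low e e≤n c e<n)

  monomials : ∀ {n} K (c : Fin K → Carrier) (e : Fin K → ℕ) → (∀ j → e j ≤ n) → Poly n
  monomials zero    c e e≤n = replicate _ 0#
  monomials (suc K) c e e≤n = monomial (e Fin.zero) (e≤n Fin.zero) (c Fin.zero)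
                            ⊞ monomials K (tail c) (tail e) (λ j → e≤n (Fin.suc j))

  eval-monomials : ∀ {n} K c e (e≤n : ∀ j → e j ≤ n) x →
                   eval (monomials K c e e≤n) x ≡ sumF F K (λ j → c j * pow F x (e j))
  eval-monomials {n} zero c e e≤n x = eval-replicate-0# (suc n) x
  eval-monomials {n} (suc K) c e e≤n x =
    trans (eval-⊞ (monomial (e Fin.zero) (e≤n Fin.zero) (c Fin.zero)) rest x)
          (cong₂ _+_ (eval-monomial (e Fin.zero) (e≤n Fin.zero) (c Fin.zero) x)
                     (eval-monomials K (tail c) (tail e) (λ j → e≤n (Fin.suc j)) x))
    where
    rest : Poly n
    rest = monomials K (tail c) (tail e) (λ j → e≤n (Fin.suc j))

  leading-monomials-low : ∀ {n} K c e (e≤n : ∀ j → e j ≤ n) → (∀ j → e j < n) →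
                          leading (monomials K c e e≤n) ≡ 0#
  leading-monomials-low {n} zero c e e≤n e<n = leading-replicate-0# n
  leading-monomials-low {n} (suc K) c e e≤n e<n =
    trans (leading-⊞ (monomial (e Fin.zero) (e≤n Fin.zero) (c Fin.zero)) rest)
          (trans (cong₂ _+_ (leading-monomial-low (e Fin.zero) (e≤n Fin.zero) (c Fin.zero) (e<n Fin.zero))
                            (leading-monomials-low K (tail c) (tail e)
                                                     (λ j → e≤n (Fin.suc j)) (λ j → e<n (Fin.suc j))))
                 (+-identityʳ 0#))
    where
    rest : Poly n
    rest = monomials K (tail c) (tail e) (λ j → e≤n (Fin.suc j))

double-pred-odd : ∀ n → 0 < n → ∃ λ u → n ℕ.+ (n ℕ.+ 0) ≡ suc (u ℕ.+ suc u)
double-pred-odd (suc u) _ = u , cong (λ k → suc (u ℕ.+ suc k)) (ℕₚ.+-identityʳ u)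

module BinaryField (r : ℕ) (F : FiniteField (2 ^ suc r)) where
  open FiniteField F
  open CommutativeRing ring using (Carrier; _+_; _*_; -_; 0#; 1#; _≈_)
  open FieldLemmas F
  open Fermat F
  private
    module R = CommutativeRing ring
    module RP = RingProperties R.ring

  -1*-1≡1 : - 1# * - 1# ≡ 1#
  -1*-1≡1 = ≈⇒≡ (R.trans (R.sym (RP.-‿distribˡ-* 1# (- 1#)))
                         (R.trans (R.-‿cong (R.*-identityˡ (- 1#))) (RP.-‿involutive 1#)))

  pow-1-odd : ∀ u → pow F (- 1#) (u ℕ.+ suc u) ≡ - 1#
  pow-1-odd u = begin
    pow F (- 1#) (u ℕ.+ suc u)       ≡⟨ pow-+ (- 1#) u (suc u) ⟩
    P * (- 1# * P)                   ≡⟨ sym (*-assoc P (- 1#) P) ⟩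
    (P * - 1#) * P                   ≡⟨ cong (_* P) (*-comm P (- 1#)) ⟩
    (- 1# * P) * P                   ≡⟨ *-assoc (- 1#) P P ⟩
    - 1# * (P * P)                   ≡⟨ cong (- 1# *_) (sym (pow-distrib-* (- 1#) (- 1#) u)) ⟩
    - 1# * pow F (- 1# * - 1#) u     ≡⟨ cong (λ y → - 1# * pow F y u) -1*-1≡1 ⟩
    - 1# * pow F 1# u                ≡⟨ cong (- 1# *_) (pow-1# u) ⟩
    - 1# * 1#                        ≡⟨ *-identityʳ _ ⟩
    - 1#                             ∎
    where
    open ≡-Reasoning
    P : Carrier
    P = pow F (- 1#) u

  -- #units = 2 ^ (r + 1) - 1 is odd, so Fermat's theorem for -1 reads -1 = 1.
  -1≡1 : - 1# ≡ 1#
  -1≡1 with double-pred-odd (2 ^ r) (ℕₚ.m^n>0 2 r)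
  ... | u , 2^r+2^r≡1+u+1+u = begin
    - 1#                         ≡⟨ sym (pow-1-odd u) ⟩
    pow F (- 1#) (u ℕ.+ suc u)   ≡⟨ cong (pow F (- 1#)) (ℕₚ.suc-injective (trans suc-#units 2^r+2^r≡1+u+1+u)) ⟨
    pow F (- 1#) #units          ≡⟨ fermat-unit -1≉0 ⟩
    1#                           ∎
    where
    open ≡-Reasoning
    -1≉0 : Nonzero (- 1#)
    -1≉0 -1≈0 = nontrivial (R.reflexive (trans (sym -1*-1≡1) (trans (cong (_* - 1#) (≈⇒≡ -1≈0)) (zeroˡ _))))

  1+1≡0 : 1# + 1# ≡ 0#
  1+1≡0 = trans (cong (1# +_) (sym -1≡1)) (≈⇒≡ (R.-‿inverseʳ 1#))

  x+x≡0 : ∀ x → x + x ≡ 0#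
  x+x≡0 x = begin
    x + x              ≡⟨ sym (cong₂ _+_ (*-identityˡ x) (*-identityˡ x)) ⟩
    1# * x + 1# * x    ≡⟨ sym (distribʳ x 1# 1#) ⟩
    (1# + 1#) * x      ≡⟨ cong (_* x) 1+1≡0 ⟩
    0# * x             ≡⟨ zeroˡ x ⟩
    0#                 ∎
    where open ≡-Reasoning

  x+y≡0⇒x≡y : ∀ {x y} → x + y ≡ 0# → x ≡ y
  x+y≡0⇒x≡y {x} {y} x+y≡0 = +-cancelˡ y x y (trans (+-comm y x) (trans x+y≡0 (sym (x+x≡0 y))))

  square-+ : ∀ x y → (x + y) * (x + y) ≡ x * x + y * y
  square-+ x y = begin
    (x + y) * (x + y)                  ≡⟨ ≈⇒≡ (solve 2 (λ x y →
                                              ((x :+ y) :* (x :+ y)) := ((x :* x :+ y :* y) :+ (x :* y :+ x :* y)))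
                                              R.refl x y) ⟩
    (x * x + y * y) + (x * y + x * y)  ≡⟨ cong ((x * x + y * y) +_) (x+x≡0 (x * y)) ⟩
    (x * x + y * y) + 0#               ≡⟨ +-identityʳ _ ⟩
    x * x + y * y                      ∎
    where open ≡-Reasoning

  frobenius : ∀ k x y → pow F (x + y) (2 ^ k) ≡ pow F x (2 ^ k) + pow F y (2 ^ k)
  frobenius zero    x y = trans (*-identityʳ _) (sym (cong₂ _+_ (*-identityʳ x) (*-identityʳ y)))
  frobenius (suc k) x y = begin
    pow F (x + y) (2 ^ suc k)              ≡⟨ pow-double (x + y) (2 ^ k) ⟩
    pow F (x + y) (2 ^ k) * pow F (x + y) (2 ^ k)
                                           ≡⟨ cong (λ z → z * z) (frobenius k x y) ⟩
    (X + Y) * (X + Y)                      ≡⟨ square-+ X Y ⟩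
    X * X + Y * Y                          ≡⟨ sym (cong₂ _+_ (pow-double x (2 ^ k)) (pow-double y (2 ^ k))) ⟩
    pow F x (2 ^ suc k) + pow F y (2 ^ suc k) ∎
    where
    open ≡-Reasoning
    X Y : Carrier
    X = pow F x (2 ^ k)
    Y = pow F y (2 ^ k)

  Tr : Carrier → Carrier
  Tr = trF F (suc r)

  tr₂ : Carrier → Bool
  tr₂ = tr F (suc r)

  Tr-+ : ∀ x y → Tr (x + y) ≡ Tr x + Tr y
  Tr-+ x y = trans (sumF-cong (suc r) (λ k → frobenius (toℕ k) x y))
                   (sumF-distrib-+ (suc r) (λ k → pow F x (2 ^ toℕ k)) (λ k → pow F y (2 ^ toℕ k)))

  Tr-0 : Tr 0# ≡ 0#
  Tr-0 = sym (+-cancelˡ (Tr 0#) 0# (Tr 0#)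
               (trans (+-identityʳ _) (trans (cong Tr (sym (+-identityʳ 0#))) (Tr-+ 0# 0#))))

  -- Squaring shifts the Frobenius powers x^(2^k) by one, and x^(2^(r+1)) = x wraps around.
  Tr-idempotent : ∀ x → Tr x * Tr x ≡ Tr x
  Tr-idempotent x = +-cancelˡ x _ _ (trans (+-comm x _) (trans rotated (+-comm _ x)))
    where
    G : ℕ → Carrier
    G k = pow F x (2 ^ k)
    squared : Tr x * Tr x ≡ sumF F (suc r) (λ k → G (suc (toℕ k)))
    squared = trans (sumF-hom (λ y → y * y) (zeroˡ 0#) square-+ (suc r) (λ k → G (toℕ k)))
                    (sumF-cong (suc r) (λ k → sym (pow-double x (2 ^ toℕ k))))
    rotated : Tr x * Tr x + x ≡ Tr x + x
    rotated = trans (cong₂ _+_ squared (sym (*-identityʳ x)))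
                    (trans (sumF-rotate (suc r) G) (cong (Tr x +_) (fermat x)))

  Tr∈𝔽₂ : ∀ x → Tr x ≡ 0# ⊎ Tr x ≡ 1#
  Tr∈𝔽₂ x with Tr x ≟ 0#
  ... | yes Tr≈0 = inj₁ (≈⇒≡ Tr≈0)
  ... | no  Tr≉0 = inj₂ (x+y≡0⇒x≡y (x*y≡0⇒y≡0 Tr≉0 (begin
    Tr x * (Tr x + 1#)       ≡⟨ distribˡ _ _ _ ⟩
    Tr x * Tr x + Tr x * 1#  ≡⟨ cong₂ _+_ (Tr-idempotent x) (*-identityʳ _) ⟩
    Tr x + Tr x              ≡⟨ x+x≡0 _ ⟩
    0#                       ∎)))
    where open ≡-Reasoning

  emb-tr₂ : ∀ x → emb F (tr₂ x) ≡ Tr x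
  emb-tr₂ x with Tr x ≟ 1# | Tr∈𝔽₂ x
  ... | yes Tr≈1 | _           = sym (≈⇒≡ Tr≈1)
  ... | no  _    | inj₁ Tr≡0   = sym Tr≡0
  ... | no  Tr≉1 | inj₂ Tr≡1   = ⊥-elim (Tr≉1 (R.reflexive Tr≡1))

  emb-injective : ∀ b c → emb F b ≡ emb F c → b ≡ c
  emb-injective false false _ = refl
  emb-injective false true  e = ⊥-elim (nontrivial (R.reflexive (sym e)))
  emb-injective true  false e = ⊥-elim (nontrivial (R.reflexive e))
  emb-injective true  true  _ = refl

  tr₂-0 : tr₂ 0# ≡ false
  tr₂-0 = emb-injective _ _ (trans (emb-tr₂ 0#) Tr-0)

  emb-xor : ∀ b c → emb F (b xor c) ≡ emb F b + emb F c
  emb-xor false false = sym (+-identityʳ 0#)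
  emb-xor false true  = sym (+-identityˡ 1#)
  emb-xor true  false = sym (+-identityʳ 1#)
  emb-xor true  true  = sym 1+1≡0

  emb-∧ : ∀ b c → emb F (b ∧ c) ≡ emb F b * emb F c
  emb-∧ false c = sym (zeroˡ _)
  emb-∧ true  c = sym (*-identityˡ _)

  tr₂-+ : ∀ x y → tr₂ (x + y) ≡ tr₂ x xor tr₂ y
  tr₂-+ x y = emb-injective _ _ (begin
    emb F (tr₂ (x + y))        ≡⟨ emb-tr₂ (x + y) ⟩
    Tr (x + y)                 ≡⟨ Tr-+ x y ⟩
    Tr x + Tr y                ≡⟨ sym (cong₂ _+_ (emb-tr₂ x) (emb-tr₂ y)) ⟩
    emb F (tr₂ x) + emb F (tr₂ y) ≡⟨ sym (emb-xor _ _) ⟩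
    emb F (tr₂ x xor tr₂ y)    ∎)
    where open ≡-Reasoning

  Tr-emb-* : ∀ b x → Tr (emb F b * x) ≡ emb F b * Tr x
  Tr-emb-* true  x = trans (cong Tr (*-identityˡ x)) (sym (*-identityˡ _))
  Tr-emb-* false x = trans (cong Tr (zeroˡ x)) (trans Tr-0 (sym (zeroˡ _)))

  tr₂-emb-* : ∀ b x → tr₂ (emb F b * x) ≡ b ∧ tr₂ x
  tr₂-emb-* false x = trans (cong tr₂ (zeroˡ x)) tr₂-0
  tr₂-emb-* true  x = cong tr₂ (*-identityˡ x)

  tr₂-+-emb : ∀ x b y → tr₂ (x + emb F b * y) ≡ tr₂ x xor (b ∧ tr₂ y)
  tr₂-+-emb x b y = trans (tr₂-+ x _) (cong (tr₂ x xor_) (tr₂-emb-* b y))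

  tr₂-linearˡ : ∀ x b y z → tr₂ ((x + emb F b * y) * z) ≡ tr₂ (x * z) xor (b ∧ tr₂ (y * z))
  tr₂-linearˡ x b y z = trans (cong tr₂ distribute) (tr₂-+-emb (x * z) b (y * z))
    where
    distribute : (x + emb F b * y) * z ≡ x * z + emb F b * (y * z)
    distribute = ≈⇒≡ (solve 4 (λ x e y z → ((x :+ e :* y) :* z) := (x :* z :+ e :* (y :* z)))
                              R.refl x (emb F b) y z)

  tr₂-linearʳ : ∀ z x b y → tr₂ (z * (x + emb F b * y)) ≡ tr₂ (z * x) xor (b ∧ tr₂ (z * y))
  tr₂-linearʳ z x b y = trans (cong tr₂ distribute) (tr₂-+-emb (z * x) b (z * y))
    where
    distribute : z * (x + emb F b * y) ≡ z * x + emb F b * (z * y)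
    distribute = ≈⇒≡ (solve 4 (λ z x e y → (z :* (x :+ e :* y)) := (z :* x :+ e :* (z :* y)))
                              R.refl z x (emb F b) y)

  combination : ∀ n → (Fin n → Carrier) → (Fin n → Bool) → Carrier
  combination n h u = sumF F n (λ i → emb F (u i) * h i)

  dotB-tr₂ : ∀ n (h : Fin n → Carrier) u a →
             dotB n u (λ i → tr₂ (a * h i)) ≡ tr₂ (a * combination n h u)
  dotB-tr₂ n h u a = emb-injective _ _ (trans (emb-dotB n h u) (sym (emb-tr₂ _)))
    where
    emb-dotB : ∀ n (h : Fin n → Carrier) u →
               emb F (dotB n u (λ i → tr₂ (a * h i))) ≡ Tr (a * combination n h u)
    emb-dotB zero    h u = sym (trans (cong Tr (zeroʳ a)) Tr-0)
    emb-dotB (suc n) h u = begin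
      emb F ((u₀ ∧ tr₂ (a * h₀)) xor rest)        ≡⟨ emb-xor _ _ ⟩
      emb F (u₀ ∧ tr₂ (a * h₀)) + emb F rest      ≡⟨ cong₂ _+_ (emb-∧ u₀ _) (emb-dotB n _ _) ⟩
      emb F u₀ * emb F (tr₂ (a * h₀)) + Tr (a * C) ≡⟨ cong (λ t → emb F u₀ * t + Tr (a * C)) (emb-tr₂ _) ⟩
      emb F u₀ * Tr (a * h₀) + Tr (a * C)         ≡⟨ cong (_+ Tr (a * C)) (sym (Tr-emb-* u₀ _)) ⟩
      Tr (emb F u₀ * (a * h₀)) + Tr (a * C)       ≡⟨ sym (Tr-+ _ _) ⟩
      Tr (emb F u₀ * (a * h₀) + a * C)            ≡⟨ cong Tr (≈⇒≡ (solve 4 (λ e a h c →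
                                                         (e :* (a :* h) :+ a :* c) := (a :* (e :* h :+ c)))
                                                         R.refl (emb F u₀) a h₀ C)) ⟩
      Tr (a * (emb F u₀ * h₀ + C))                ∎
      where
      open ≡-Reasoning
      u₀ rest : Bool
      u₀ = u Fin.zero
      rest = dotB n (λ i → u (Fin.suc i)) (λ i → tr₂ (a * h (Fin.suc i)))
      h₀ C : Carrier
      h₀ = h Fin.zero
      C = combination n (λ i → h (Fin.suc i)) (λ i → u (Fin.suc i))

  dotB-cong : ∀ n u {v w : Fin n → Bool} → (∀ i → v i ≡ w i) → dotB n u v ≡ dotB n u w
  dotB-cong zero    u v≗w = refl
  dotB-cong (suc n) u v≗w =
    cong₂ _xor_ (cong (u Fin.zero ∧_) (v≗w Fin.zero)) (dotB-cong n _ (λ i → v≗w (Fin.suc i)))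

  dotB-zeroʳ : ∀ n u {v : Fin n → Bool} → (∀ i → v i ≡ false) → dotB n u v ≡ false
  dotB-zeroʳ zero    u v≗0 = refl
  dotB-zeroʳ (suc n) u v≗0 =
    cong₂ _xor_ (trans (cong (u Fin.zero ∧_) (v≗0 Fin.zero)) (∧-zeroʳ _))
                (dotB-zeroʳ n _ (λ i → v≗0 (Fin.suc i)))

  Annihilates : ∀ n → (Fin n → Carrier) → Carrier → Set
  Annihilates n h c = ∀ i → tr₂ (c * h i) ≡ false

  annihilates-combination : ∀ n h c u → Annihilates n h c → tr₂ (c * combination n h u) ≡ false
  annihilates-combination n h c u ann = trans (sym (dotB-tr₂ n h u c)) (dotB-zeroʳ n u ann)

  dvec-∈-D⊥ : ∀ N g a → InD⊥ F N g (dvec F (suc r) N g a)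
  dvec-∈-D⊥ N g a u u∈D = begin
    dotB N u (λ i → tr₂ (a * g i))  ≡⟨ dotB-tr₂ N g u a ⟩
    tr₂ (a * combination N g u)     ≡⟨ cong (λ z → tr₂ (a * z)) (≈⇒≡ u∈D) ⟩
    tr₂ (a * 0#)                    ≡⟨ cong tr₂ (zeroʳ a) ⟩
    tr₂ 0#                          ≡⟨ tr₂-0 ⟩
    false                           ∎
    where open ≡-Reasoning

  dvec-+ : ∀ N g a b i → dvec F (suc r) N g (a + b) i ≡ (dvec F (suc r) N g a i xor dvec F (suc r) N g b i)
  dvec-+ N g a b i = trans (cong tr₂ (distribʳ (g i) a b)) (tr₂-+ _ _)

  dvec-emb-* : ∀ N g c a i → dvec F (suc r) N g (emb F c * a) i ≡ (c ∧ dvec F (suc r) N g a i)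
  dvec-emb-* N g c a i = trans (cong tr₂ (*-assoc _ _ _)) (tr₂-emb-* c _)

  dvec-injective : ∀ N g → (∀ {c} → Nonzero c → ∃ λ i → tr₂ (c * g i) ≡ true) →
                   ∀ a b → (∀ i → dvec F (suc r) N g a i ≡ dvec F (suc r) N g b i) → a ≡ b
  dvec-injective N g detects a b da≗db with (a + b) ≟ 0#
  ... | yes a+b≈0 = x+y≡0⇒x≡y (≈⇒≡ a+b≈0)
  ... | no  a+b≉0 with detects a+b≉0
  ...   | i , tr₂≡1 = ⊥-elim (false≢true (begin
    false                          ≡⟨ sym (xor-same (tr₂ (b * g i))) ⟩
    tr₂ (b * g i) xor tr₂ (b * g i) ≡⟨ cong (_xor tr₂ (b * g i)) (sym (da≗db i)) ⟩
    tr₂ (a * g i) xor tr₂ (b * g i) ≡⟨ sym (dvec-+ N g a b i) ⟩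
    tr₂ ((a + b) * g i)            ≡⟨ tr₂≡1 ⟩
    true                           ∎))
    where
    open ≡-Reasoning
    false≢true : ¬ false ≡ true
    false≢true ()

  xor-cancelˡ : ∀ x y → x xor (x xor y) ≡ y
  xor-cancelˡ x y = trans (sym (xor-assoc x x y)) (cong (_xor y) (xor-same x))

  a+[y+a]≡y : ∀ a y → a + (y + a) ≡ y
  a+[y+a]≡y a y = begin
    a + (y + a)   ≡⟨ cong (a +_) (+-comm y a) ⟩
    a + (a + y)   ≡⟨ sym (+-assoc a a y) ⟩
    (a + a) + y   ≡⟨ cong (_+ y) (x+x≡0 a) ⟩
    0# + y        ≡⟨ +-identityˡ y ⟩
    y             ∎
    where open ≡-Reasoning

  -- Gaussian elimination over F₂, one generator h i at a time; x₀ makes the trace form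
  -- nondegenerate.
  module TraceDuality (x₀ : Carrier) (tr₂-x₀ : tr₂ x₀ ≡ true) where

    combination-or-separated : ∀ n (h : Fin n → Carrier) y →
      (∃ λ u → combination n h u ≡ y) ⊎ (∃ λ c → Annihilates n h c × tr₂ (c * y) ≡ true)
    combination-or-separated zero h y with y ≟ 0#
    ... | yes y≈0 = inj₁ ((λ ()) , sym (≈⇒≡ y≈0))
    ... | no  y≉0 = inj₂ (x₀ * y ⁻¹ , (λ ()) , trans (cong tr₂ x₀y⁻¹y≡x₀) tr₂-x₀)
      where
      x₀y⁻¹y≡x₀ : x₀ * y ⁻¹ * y ≡ x₀
      x₀y⁻¹y≡x₀ = trans (*-assoc _ _ _) (trans (cong (x₀ *_) (⁻¹-inverseˡ y≉0)) (*-identityʳ x₀))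
    combination-or-separated (suc n) h y
      with combination-or-separated n (tail h) (head h)
    ... | inj₁ (u₀ , h₀≡comb) with combination-or-separated n (tail h) y
    ...   | inj₁ (u , y≡comb) =
            inj₁ (false ∷ᵥ u , trans (cong (_+ combination n (tail h) u) (zeroˡ _))
                                     (trans (+-identityˡ _) y≡comb))
    ...   | inj₂ (c , ann , sep) = inj₂ (c , ann′ , sep)
      where
      ann′ : Annihilates (suc n) h c
      ann′ Fin.zero    = trans (cong (λ z → tr₂ (c * z)) (sym h₀≡comb))
                               (annihilates-combination n (tail h) c u₀ ann)
      ann′ (Fin.suc i) = ann i
    combination-or-separated (suc n) h y
        | inj₂ (c₀ , ann₀ , sep₀)
        with combination-or-separated n (tail h) (y + emb F (tr₂ (c₀ * y)) * head h)
    ...   | inj₁ (u , comb≡) =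
            inj₁ (tr₂ (c₀ * y) ∷ᵥ u ,
                  trans (cong (emb F (tr₂ (c₀ * y)) * head h +_) comb≡) (a+[y+a]≡y _ y))
    ...   | inj₂ (c , ann , sep) = inj₂ (c + emb F β * c₀ , ann′ , sep′)
      where
      β₀ β : Bool
      β₀ = tr₂ (c₀ * y)
      β = tr₂ (c * head h)
      ann′ : Annihilates (suc n) h (c + emb F β * c₀)
      ann′ Fin.zero = begin
        tr₂ ((c + emb F β * c₀) * head h)     ≡⟨ tr₂-linearˡ c β c₀ (head h) ⟩
        β xor (β ∧ tr₂ (c₀ * head h))         ≡⟨ cong (λ t → β xor (β ∧ t)) sep₀ ⟩
        β xor (β ∧ true)                      ≡⟨ cong (β xor_) (∧-identityʳ β) ⟩
        β xor β                               ≡⟨ xor-same β ⟩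
        false                                 ∎
        where open ≡-Reasoning
      ann′ (Fin.suc i) = begin
        tr₂ ((c + emb F β * c₀) * h (Fin.suc i))  ≡⟨ tr₂-linearˡ c β c₀ _ ⟩
        tr₂ (c * h (Fin.suc i)) xor (β ∧ tr₂ (c₀ * h (Fin.suc i)))
                                                  ≡⟨ cong₂ (λ s t → s xor (β ∧ t)) (ann i) (ann₀ i) ⟩
        false xor (β ∧ false)                     ≡⟨ ∧-zeroʳ β ⟩
        false                                     ∎
        where open ≡-Reasoning
      sep′ : tr₂ ((c + emb F β * c₀) * y) ≡ true
      sep′ = begin
        tr₂ ((c + emb F β * c₀) * y)           ≡⟨ tr₂-linearˡ c β c₀ y ⟩
        tr₂ (c * y) xor (β ∧ β₀)               ≡⟨ cong (tr₂ (c * y) xor_) (∧-comm β β₀) ⟩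
        tr₂ (c * y) xor (β₀ ∧ β)               ≡⟨ sym (tr₂-linearʳ c y β₀ (head h)) ⟩
        tr₂ (c * (y + emb F β₀ * head h))      ≡⟨ sep ⟩
        true                                   ∎
        where open ≡-Reasoning

    trace-vector-of-orthogonal : ∀ n (h : Fin n → Carrier) (v : Fin n → Bool) →
      (∀ u → combination n h u ≡ 0# → dotB n u v ≡ false) → ∃ λ a → ∀ i → tr₂ (a * h i) ≡ v i
    trace-vector-of-orthogonal zero h v v⊥ = 0# , λ ()
    trace-vector-of-orthogonal (suc n) h v v⊥
      with trace-vector-of-orthogonal n (tail h) (tail v) tail-v⊥
         | combination-or-separated n (tail h) (head h)
      where
      tail-v⊥ : ∀ u → combination n (tail h) u ≡ 0# → dotB n u (tail v) ≡ false
      tail-v⊥ u comb≡0 = v⊥ (false ∷ᵥ u) (trans (cong (_+ combination n (tail h) u) (zeroˡ _))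
                                                (trans (+-identityˡ _) comb≡0))
    ... | a , a-tail | inj₁ (u , comb≡h₀) = a , a-all
      where
      open ≡-Reasoning
      in-kernel : combination (suc n) h (true ∷ᵥ u) ≡ 0#
      in-kernel = trans (cong₂ _+_ (*-identityˡ _) comb≡h₀) (x+x≡0 _)
      dotB≡tr₂ : dotB n u (tail v) ≡ tr₂ (a * head h)
      dotB≡tr₂ = begin
        dotB n u (tail v)                        ≡⟨ dotB-cong n u (λ i → sym (a-tail i)) ⟩
        dotB n u (λ i → tr₂ (a * tail h i))      ≡⟨ dotB-tr₂ n (tail h) u a ⟩
        tr₂ (a * combination n (tail h) u)       ≡⟨ cong (λ z → tr₂ (a * z)) comb≡h₀ ⟩
        tr₂ (a * head h)                         ∎
      a-all : ∀ i → tr₂ (a * h i) ≡ v i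
      a-all Fin.zero = begin
        tr₂ (a * head h)                             ≡⟨ sym (xor-cancelˡ (head v) _) ⟩
        head v xor (head v xor tr₂ (a * head h))     ≡⟨ cong (λ t → head v xor (head v xor t)) (sym dotB≡tr₂) ⟩
        head v xor dotB (suc n) (true ∷ᵥ u) v        ≡⟨ cong (head v xor_) (v⊥ (true ∷ᵥ u) in-kernel) ⟩
        head v xor false                             ≡⟨ xor-identityʳ _ ⟩
        head v                                       ∎
      a-all (Fin.suc i) = a-tail i
    ... | a , a-tail | inj₂ (c , ann , sep) = a + emb F β * c , a′-all
      where
      open ≡-Reasoning
      β : Bool
      β = tr₂ (a * head h) xor head v
      a′-all : ∀ i → tr₂ ((a + emb F β * c) * h i) ≡ v i
      a′-all Fin.zero = begin
        tr₂ ((a + emb F β * c) * head h)            ≡⟨ tr₂-linearˡ a β c (head h) ⟩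
        tr₂ (a * head h) xor (β ∧ tr₂ (c * head h)) ≡⟨ cong (λ t → tr₂ (a * head h) xor (β ∧ t)) sep ⟩
        tr₂ (a * head h) xor (β ∧ true)             ≡⟨ cong (tr₂ (a * head h) xor_) (∧-identityʳ β) ⟩
        tr₂ (a * head h) xor β                      ≡⟨ xor-cancelˡ (tr₂ (a * head h)) (head v) ⟩
        head v                                      ∎
      a′-all (Fin.suc i) = begin
        tr₂ ((a + emb F β * c) * h (Fin.suc i))     ≡⟨ tr₂-linearˡ a β c _ ⟩
        tr₂ (a * h (Fin.suc i)) xor (β ∧ tr₂ (c * h (Fin.suc i)))
                                                    ≡⟨ cong₂ (λ s t → s xor (β ∧ t)) (a-tail i) (ann i) ⟩
        v (Fin.suc i) xor (β ∧ false)               ≡⟨ cong (v (Fin.suc i) xor_) (∧-zeroʳ β) ⟩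
        v (Fin.suc i) xor false                     ≡⟨ xor-identityʳ _ ⟩
        v (Fin.suc i)                               ∎

    D⊥⊆dvec-image : ∀ N g v → InD⊥ F N g v → ∃ λ a → ∀ i → dvec F (suc r) N g a i ≡ v i
    D⊥⊆dvec-image N g v v∈D⊥ = trace-vector-of-orthogonal N g v (λ u u∈D → v∈D⊥ u (R.reflexive u∈D))

  gvec-attains : ∀ m N ord → IsOrdering F (suc m) N ord →
                 ∀ {x} → Nonzero x → ∃ λ i → gvec F (suc m) N ord i ≡ x + x ⁻¹
  gvec-attains m N ord ordering {x} x≉0
    with IsOrdering.surj ordering (x ∷ᵥ λ _ → 1#) (λ { Fin.zero → x≉0 ; (Fin.suc _) → nontrivial })
  ... | i , ordᵢ≗x∷1s = i , (begin
    sumF F (suc m) (ord i) + sumF F (suc m) (λ k → ord i k ⁻¹)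
      ≡⟨ cong₂ _+_ (sumF-cong (suc m) ordᵢ≗x∷1s) (sumF-cong (suc m) (λ k → cong _⁻¹ (ordᵢ≗x∷1s k))) ⟩
    (x + ones) + (x ⁻¹ + sumF F m (λ _ → 1# ⁻¹))
      ≡⟨ cong (λ y → (x + ones) + (x ⁻¹ + y)) (sumF-cong m (λ _ → 1⁻¹≡1)) ⟩
    (x + ones) + (x ⁻¹ + ones)
      ≡⟨ ≈⇒≡ (solve 3 (λ a b c → ((a :+ c) :+ (b :+ c)) := ((a :+ b) :+ (c :+ c))) R.refl x (x ⁻¹) ones) ⟩
    (x + x ⁻¹) + (ones + ones)
      ≡⟨ cong ((x + x ⁻¹) +_) (x+x≡0 ones) ⟩
    (x + x ⁻¹) + 0#
      ≡⟨ +-identityʳ _ ⟩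
    x + x ⁻¹
      ∎)
    where
    open ≡-Reasoning
    ones : Carrier
    ones = sumF F m (λ _ → 1#)

-- The polynomial Σₖ c^(2^k) (x^(1 + 2^k) + x^(q - 2^k)) equals x · Tr (c (x + x⁻¹)) on all of F,
-- since x^(q - 2^k) = x · (x⁻¹)^(2^k).  When q > 4 its coefficient of x^(q - 1) is c (from k = 0)
-- and all other exponents are smaller, so for c ≠ 0 it cannot vanish at all q points.
module Kloosterman (s : ℕ) (F : FiniteField (2 ^ (3 ℕ.+ s))) where
  open FiniteField F
  open CommutativeRing ring using (Carrier; _+_; _*_; 0#; 1#; _≈_)
  open FieldLemmas F
  open Fermat F
  open Polynomials F
  open BinaryField (2 ℕ.+ s) F
  private module R = CommutativeRing ring

  private
    q H : ℕ
    q = 2 ^ (3 ℕ.+ s)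
    H = 2 ^ (2 ℕ.+ s)

    2^k≤H : ∀ (k : Fin (3 ℕ.+ s)) → 2 ^ toℕ k ≤ H
    2^k≤H k = ℕₚ.^-monoʳ-≤ 2 (ℕₚ.≤-pred (Finₚ.toℕ<n k))

    q≡H+H : q ≡ H ℕ.+ H
    q≡H+H = cong (H ℕ.+_) (ℕₚ.+-identityʳ H)

    2^k<q : ∀ (k : Fin (3 ℕ.+ s)) → 2 ^ toℕ k < q
    2^k<q k = subst (2 ^ toℕ k <_) (sym q≡H+H)
                    (ℕₚ.≤-trans (s≤s (2^k≤H k)) (ℕₚ.m<m+n H (ℕₚ.m^n>0 2 (2 ℕ.+ s))))

    1+2^k<q∸1 : ∀ (k : Fin (3 ℕ.+ s)) → suc (2 ^ toℕ k) < q ∸ 1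
    1+2^k<q∸1 k =
      ℕₚ.∸-monoˡ-≤ 1 (subst (3 ℕ.+ 2 ^ toℕ k ≤_) (sym q≡H+H) (ℕₚ.+-mono-≤ 3≤H (2^k≤H k)))
      where
      3≤H : 3 ≤ H
      3≤H = ℕₚ.≤-trans (ℕₚ.n≤1+n 3) (ℕₚ.^-monoʳ-≤ 2 {2} {2 ℕ.+ s} (s≤s (s≤s z≤n)))

    1+2^k≤q∸1 : ∀ (k : Fin (3 ℕ.+ s)) → suc (2 ^ toℕ k) ≤ q ∸ 1
    1+2^k≤q∸1 k = ℕₚ.<⇒≤ (1+2^k<q∸1 k)

    q∸2^k≤q∸1 : ∀ (k : Fin (3 ℕ.+ s)) → q ∸ 2 ^ toℕ k ≤ q ∸ 1
    q∸2^k≤q∸1 k = ℕₚ.∸-monoʳ-≤ q (ℕₚ.m^n>0 2 (toℕ k))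

    q∸2^[1+k]<q∸1 : ∀ (k : Fin (2 ℕ.+ s)) → q ∸ 2 ^ suc (toℕ k) < q ∸ 1
    q∸2^[1+k]<q∸1 k =
      ℕₚ.∸-monoʳ-< (ℕₚ.^-monoʳ-≤ 2 {1} {suc (toℕ k)} (s≤s z≤n)) (ℕₚ.<⇒≤ (2^k<q (Fin.suc k)))

  coefficient : Carrier → Fin (3 ℕ.+ s) → Carrier
  coefficient c k = pow F c (2 ^ toℕ k)

  xPart x⁻¹Part : Carrier → Poly (q ∸ 1)
  xPart   c = monomials (3 ℕ.+ s) (coefficient c) (λ k → suc (2 ^ toℕ k)) 1+2^k≤q∸1
  x⁻¹Part c = monomials (3 ℕ.+ s) (coefficient c) (λ k → q ∸ 2 ^ toℕ k) q∸2^k≤q∸1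

  kloostermanPoly : Carrier → Poly (q ∸ 1)
  kloostermanPoly c = xPart c ⊞ x⁻¹Part c

  eval-kloostermanPoly : ∀ c x → eval (kloostermanPoly c) x ≡ x * Tr (c * (x + x ⁻¹))
  eval-kloostermanPoly c x = begin
    eval (kloostermanPoly c) x
      ≡⟨ eval-⊞ (xPart c) (x⁻¹Part c) x ⟩
    eval (xPart c) x + eval (x⁻¹Part c) x
      ≡⟨ cong₂ _+_ (eval-monomials (3 ℕ.+ s) (coefficient c) _ 1+2^k≤q∸1 x)
                   (eval-monomials (3 ℕ.+ s) (coefficient c) _ q∸2^k≤q∸1 x) ⟩
    sumF F (3 ℕ.+ s) (λ k → pow F c (K k) * pow F x (suc (K k)))
      + sumF F (3 ℕ.+ s) (λ k → pow F c (K k) * pow F x (q ∸ K k))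
      ≡⟨ cong₂ _+_ (sumF-cong (3 ℕ.+ s) term₁) (sumF-cong (3 ℕ.+ s) term₂) ⟩
    sumF F (3 ℕ.+ s) (λ k → x * pow F (c * x) (K k))
      + sumF F (3 ℕ.+ s) (λ k → x * pow F (c * x ⁻¹) (K k))
      ≡⟨ sym (cong₂ _+_ (*-distribˡ-sumF (3 ℕ.+ s) x (λ k → pow F (c * x) (K k)))
                        (*-distribˡ-sumF (3 ℕ.+ s) x (λ k → pow F (c * x ⁻¹) (K k)))) ⟩
    x * Tr (c * x) + x * Tr (c * x ⁻¹)
      ≡⟨ sym (distribˡ x _ _) ⟩
    x * (Tr (c * x) + Tr (c * x ⁻¹))
      ≡⟨ cong (x *_) (sym (Tr-+ _ _)) ⟩
    x * Tr (c * x + c * x ⁻¹)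
      ≡⟨ cong (λ y → x * Tr y) (sym (distribˡ c x (x ⁻¹))) ⟩
    x * Tr (c * (x + x ⁻¹))
      ∎
    where
    open ≡-Reasoning
    K : Fin (3 ℕ.+ s) → ℕ
    K k = 2 ^ toℕ k
    swap : ∀ a b c → a * (b * c) ≡ b * (a * c)
    swap a b c = ≈⇒≡ (solve 3 (λ a b c → (a :* (b :* c)) := (b :* (a :* c))) R.refl a b c)
    term₁ : ∀ k → pow F c (K k) * pow F x (suc (K k)) ≡ x * pow F (c * x) (K k)
    term₁ k = trans (swap _ x _) (cong (x *_) (sym (pow-distrib-* c x (K k))))
    term₂ : ∀ k → pow F c (K k) * pow F x (q ∸ K k) ≡ x * pow F (c * x ⁻¹) (K k)
    term₂ k = trans (cong (pow F c (K k) *_) (pow-∸ x (2^k<q k)))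
                    (trans (swap _ x _) (cong (x *_) (sym (pow-distrib-* c (x ⁻¹) (K k)))))

  leading-kloostermanPoly : ∀ c → leading (kloostermanPoly c) ≡ c * 1#
  leading-kloostermanPoly c = begin
    leading (xPart c ⊞ x⁻¹Part c)
      ≡⟨ leading-⊞ (xPart c) (x⁻¹Part c) ⟩
    leading (xPart c) + leading (monomial (q ∸ 1) (q∸2^k≤q∸1 Fin.zero) (c * 1#) ⊞ x⁻¹Tail)
      ≡⟨ cong₂ _+_ (leading-monomials-low (3 ℕ.+ s) (coefficient c) _ 1+2^k≤q∸1 1+2^k<q∸1)
                   (leading-⊞ (monomial (q ∸ 1) (q∸2^k≤q∸1 Fin.zero) (c * 1#)) x⁻¹Tail) ⟩
    0# + (leading (monomial (q ∸ 1) (q∸2^k≤q∸1 Fin.zero) (c * 1#)) + leading x⁻¹Tail)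
      ≡⟨ cong (0# +_) (cong₂ _+_ (leading-monomial-top (q ∸ 1) (q∸2^k≤q∸1 Fin.zero) (c * 1#))
                                 (leading-monomials-low (2 ℕ.+ s) (λ k → coefficient c (Fin.suc k)) _
                                                        (λ k → q∸2^k≤q∸1 (Fin.suc k)) q∸2^[1+k]<q∸1)) ⟩
    0# + (c * 1# + 0#)
      ≡⟨ trans (+-identityˡ _) (+-identityʳ _) ⟩
    c * 1#
      ∎
    where
    open ≡-Reasoning
    x⁻¹Tail : Poly (q ∸ 1)
    x⁻¹Tail = monomials (2 ℕ.+ s) (λ k → coefficient c (Fin.suc k)) (λ k → q ∸ 2 ^ suc (toℕ k))
                                  (λ k → q∸2^k≤q∸1 (Fin.suc k))

  kloosterman : ∀ {c} → Nonzero c → ∃ λ x → Nonzero x × tr₂ (c * (x + x ⁻¹)) ≡ true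
  kloosterman {c} c≉0
    with Finₚ.any? (λ i → ¬? (enum i ≟ 0#) ×-dec (tr₂ (c * (enum i + enum i ⁻¹)) Bool.≟ true))
  ... | yes (i , x≉0 , tr₂≡1) = enum i , x≉0 , tr₂≡1
  ... | no  none = ⊥-elim (c≉0 (R.reflexive c≡0))
    where
    roots : ∀ i → eval (kloostermanPoly c) (enum i) ≡ 0#
    roots i with enum i ≟ 0#
    ... | yes x≈0 = trans (eval-kloostermanPoly c _)
                          (trans (cong (_* Tr (c * (enum i + enum i ⁻¹))) (≈⇒≡ x≈0)) (zeroˡ _))
    ... | no  x≉0 = trans (eval-kloostermanPoly c _) (trans (cong (enum i *_) Tr≡0) (zeroʳ _))
      where
      Tr≡0 : Tr (c * (enum i + enum i ⁻¹)) ≡ 0#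
      Tr≡0 = trans (sym (emb-tr₂ _)) (cong (emb F) (¬-not (λ tr₂≡1 → none (i , x≉0 , tr₂≡1))))
    c≡0 : c ≡ 0#
    c≡0 = trans (sym (*-identityʳ c))
                (trans (sym (leading-kloostermanPoly c))
                       (many-roots⇒leading≡0 (kloostermanPoly c) enum enum-inj
                                           (ℕₚ.∸-monoʳ-< (s≤s z≤n) (ℕₚ.m^n>0 2 (3 ℕ.+ s))) roots))

  trace-one : ∃ λ x → tr₂ x ≡ true
  trace-one with kloosterman nontrivial
  ... | x , _ , tr₂≡1 = 1# * (x + x ⁻¹) , tr₂≡1

proposition21 : (r : ℕ) → 3 ≤ r → (F : FiniteField (2 ^ r)) →
    (m : ℕ) → 1 ≤ m →
    let open CommutativeRing (FiniteField.ring F)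
        N = (2 ^ r ∸ 1) ^ m
    in (ord : Fin N → Fin m → Carrier) → IsOrdering F m N ord →
    let g = gvec F m N ord
        d = dvec F r N g
    in ((a : Carrier) → InD⊥ F N g (d a))
       × ((a b : Carrier) → (i : Fin N) → d (a + b) i ≡ (d a i xor d b i))
       × ((c : Bool) → (a : Carrier) → (i : Fin N) → d (emb F c * a) i ≡ (c ∧ d a i))
       × ((a b : Carrier) → ((i : Fin N) → d a i ≡ d b i) → a ≡ b)
       × ((v : Fin N → Bool) → InD⊥ F N g v → ∃ λ a → (i : Fin N) → d a i ≡ v i)
proposition21 (suc (suc (suc s))) (s≤s (s≤s (s≤s _))) F (suc m) (s≤s _) ord ordering =
  dvec-∈-D⊥ N g , dvec-+ N g , dvec-emb-* N g , dvec-injective N g detects-nonzero , D⊥⊆dvec-image N g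
  where
  open FiniteField F using (_⁻¹)
  open CommutativeRing (FiniteField.ring F) using (Carrier; _*_)
  open FieldLemmas F using (Nonzero)
  open BinaryField (2 ℕ.+ s) F
  open Kloosterman s F using (kloosterman; trace-one)
  open TraceDuality (proj₁ trace-one) (proj₂ trace-one)
  N : ℕ
  N = (2 ^ (3 ℕ.+ s) ∸ 1) ^ suc m
  g : Fin N → Carrier
  g = gvec F (suc m) N ord
  detects-nonzero : ∀ {c} → Nonzero c → ∃ λ i → tr₂ (c * g i) ≡ true
  detects-nonzero {c} c≉0 with kloosterman c≉0
  ... | x , x≉0 , tr₂≡1 with gvec-attains m N ord ordering x≉0
  ...   | i , gᵢ≡x+x⁻¹ = i , trans (cong (λ y → tr₂ (c * y)) gᵢ≡x+x⁻¹) tr₂≡1
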